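{- Let $U=\{1,\dots,n\}$ be jobs, $V=\{1,\dots,m\}$ machines, and $b(j,i)\ge 0$ integer tolerances forming a monotonous instance, i.e., $b(j,i)\le b(j,i')$ for all $j$ and $i<i'$, and $b(j,i)\le b(j',i)$ for all $i$ and $j<j'$. Then there is a maximum-cardinality PD-matching $M^*$ such that, with $j^*=n-|M^*|+1$, a job $j$ is matched in $M^*$ if and only if $j\ge j^*$, and there is some $i^*\in V$ such that a machine $i$ has $d_i(M^*)>0$ if and only if $i\ge i^*$.
   Context: A PD-matching is a set $M\subseteq U\times V$ such that every job belongs to at most one pair of $M$, and for every $(j,i)\in M$, $d_i(M)\le b(j,i)$, where $d_i(M)=|\{j:(j,i)\in M\}|$. A job is matched in $M$ if it belongs to a pair of $M$. -}

module Defs where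

open import Data.Nat using (ℕ; zero; suc; _+_; _≤_; _<_)
open import Data.Fin using (Fin; toℕ)
open import Data.Maybe using (Maybe; just; nothing)
open import Data.Bool using (Bool; true; false)
open import Data.List using (List; length; filterᵇ; allFin)
open import Data.Product using (_×_)
open import Relation.Nullary using (Dec; yes; no; ¬_)
open import Relation.Binary.PropositionalEquality using (_≡_)
open import Data.Fin using (_≟_)

-- Jobs U = Fin n, machines V = Fin m (0-indexed: paper's job j is Fin index j-1).
-- Tolerances b : Fin n → Fin m → ℕ  (b j i = b(j,i)).

Monotonous : {n m : ℕ} → (Fin n → Fin m → ℕ) → Set
Monotonous {n} {m} b =
  ((j : Fin n) (i i' : Fin m) → toℕ i < toℕ i' → b j i ≤ b j i') ×
  ((i : Fin m) (j j' : Fin n) → toℕ j < toℕ j' → b j i ≤ b j' i)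

-- A set M ⊆ U × V in which every job belongs to at most one pair is
-- exactly a partial assignment of jobs to machines.
Assignment : ℕ → ℕ → Set
Assignment n m = Fin n → Maybe (Fin m)

assignedTo : {n m : ℕ} → Assignment n m → Fin m → Fin n → Bool
assignedTo M i j with M j
... | nothing = false
... | just i' with i' ≟ i
...   | yes _ = true
...   | no _ = false

isJust : {m : ℕ} → Maybe (Fin m) → Bool
isJust nothing = false
isJust (just _) = true

degree : {n m : ℕ} → Assignment n m → Fin m → ℕ
degree {n} M i = length (filterᵇ (assignedTo M i) (allFin n))

size : {n m : ℕ} → Assignment n m → ℕ
size {n} M = length (filterᵇ (λ j → isJust (M j)) (allFin n))

Matched : {n m : ℕ} → Assignment n m → Fin n → Set
Matched M j = isJust (M j) ≡ true

IsPDMatching : {n m : ℕ} → (Fin n → Fin m → ℕ) → Assignment n m → Set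
IsPDMatching b M = ∀ j i → M j ≡ just i → degree M i ≤ b j i

IsMaxPDMatching : {n m : ℕ} → (Fin n → Fin m → ℕ) → Assignment n m → Set
IsMaxPDMatching {n} {m} b M =
  IsPDMatching b M × ((M' : Assignment n m) → IsPDMatching b M' → size M' ≤ size M)

{-# OPTIONS --safe #-}
module Submission where

-- Among the maximum PD-matchings choose one maximising the potential
--   Σ { j | j matched } j  +  Σ { i | d_i > 0 } i.
-- If a matched job j preceded an unmatched job j′, relabelling the jobs by the
-- transposition (j j′) would keep every degree and the size, and, since
-- tolerances grow with the job index, the PD condition, while raising the
-- potential. Symmetrically for a used machine i before an unused machine i′,
-- since tolerances grow with the machine index. So the matched jobs and the used
-- machines form final segments, and a final segment of {0, …, n-1} is determined
-- by its size.

open import Defs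
open import Data.Nat using (ℕ; _+_; _≤_; _<_)
open import Data.Fin using (Fin; toℕ)
open import Data.Product using (_×_; Σ; ∃-syntax)
open import Function.Bundles using (_⇔_)

open import Data.Bool using (Bool; true; false; if_then_else_)
open import Data.Bool.Properties using (T-≡)
open import Data.Fin using (zero; suc; _≟_)
open import Data.Fin.Permutation
  using (Permutation′; _⟨$⟩ʳ_; _⟨$⟩ˡ_; inverseˡ; inverseʳ; transpose)
open import Data.Fin.Properties using (all?; toℕ-injective)
open import Data.List using (List; _∷_; length; filterᵇ; allFin; tabulate; map)
open import Data.List.Extrema.Nat using (argmax; f[xs]≤f[argmax])
open import Data.List.Membership.Propositional using (_∈_)
open import Data.List.Membership.Propositional.Properties using (∈-map⁺; ∈-allFin)
import Data.List.Relation.Unary.All as All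
open import Data.List.Relation.Unary.Any using (here; there)
open import Data.Maybe as Maybe using (Maybe; just; nothing)
import Data.Maybe.Properties as Maybe
import Data.Nat as ℕ
open import Data.Nat using (zero; suc; z≤n; s≤s; s≤s⁻¹; z<s; s<s; _∸_; _<ᵇ_; _≤?_)
open import Data.Nat.Properties hiding (_≟_)
open import Algebra.Properties.CommutativeMonoid.Sum +-0-commutativeMonoid
  using (sum; sum-cong-≗; sum-permute)
open import Data.Product using (_,_; proj₁; proj₂)
open import Data.Sum using (inj₁; inj₂)
open import Data.Vec.Functional using (Vector; head; tail) renaming (_∷_ to _◂_)
open import Function using (_∘_; const; id)
open import Function.Bundles using (mk⇔; Equivalence)
open import Function.Construct.Composition using (_⇔-∘_)
open import Function.Construct.Symmetry using (⇔-sym)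
open import Relation.Nullary using (Dec; yes; no; does; contradiction)
open import Relation.Nullary.Decidable using (dec-true; dec-false; _×-dec_; _→-dec_)
open import Relation.Unary using (Decidable)
open import Relation.Binary.PropositionalEquality

private
  variable
    n m : ℕ

guard : {X : Set} → Dec X → ℕ → ℕ
guard (yes _) k = suc k
guard (no _)  k = 0

guard-cong : {X Y : Set} (x? : Dec X) (y? : Dec Y) → (X → Y) → (Y → X) →
             ∀ {k l} → k ≡ l → guard x? k ≡ guard y? l
guard-cong (yes _) (yes _) _   _   k≡l = cong suc k≡l
guard-cong (yes x) (no ¬y) x→y _   _   = contradiction (x→y x) ¬y
guard-cong (no ¬x) (yes y) _   y→x _   = contradiction (y→x y) ¬x
guard-cong (no _)  (no _)  _   _   _   = refl

guard-≤ : {X Y : Set} (x? : Dec X) (y? : Dec Y) → ∀ {k l} →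
          guard x? k ≤ guard y? l → X → Y × k ≤ l
guard-≤ (yes _) (yes y) (s≤s k≤l) _ = y , k≤l
guard-≤ (no ¬x) _       _         x = contradiction x ¬x

module _ {A : Set} (a₀ : A) (as : List A) (complete : ∀ a → a ∈ as) where

  maximise : ∀ n (t : Vector A n → ℕ) → (∀ {f g} → f ≗ g → t f ≡ t g) →
             ∃[ f ] ∀ g → t g ≤ t f
  maximise zero    t t-cong = (λ ()) , λ g → ≤-reflexive (t-cong λ ())
  maximise (suc n) t t-cong = best ◂ completion best , bound
    where
    optimalTail : ∀ a → ∃[ f ] ∀ g → t (a ◂ g) ≤ t (a ◂ f)
    optimalTail a =
      maximise n (t ∘ (a ◂_)) λ f≗g → t-cong λ { zero → refl ; (suc i) → f≗g i }
    completion : A → Vector A n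
    completion a = proj₁ (optimalTail a)
    value : A → ℕ
    value a = t (a ◂ completion a)
    best : A
    best = argmax value a₀ as
    bound : ∀ g → t g ≤ value best
    bound g = begin
      t g                  ≡⟨ t-cong (λ { zero → refl ; (suc i) → refl }) ⟩
      t (head g ◂ tail g)  ≤⟨ proj₂ (optimalTail (head g)) (tail g) ⟩
      value (head g)       ≤⟨ All.lookup (f[xs]≤f[argmax] {f = value} a₀ as) (complete (head g)) ⟩
      value best           ∎
      where open ≤-Reasoning

  maximiseOn : (P : Vector A n → Set) → Decidable P → (∀ {f g} → f ≗ g → P f → P g) →
               (s : Vector A n → ℕ) → (∀ {f g} → f ≗ g → s f ≡ s g) →
               ∀ {f₀} → P f₀ → ∃[ f ] P f × (∀ g → P g → s g ≤ s f)
  maximiseOn {n} P P? P-cong s s-cong {f₀} Pf₀ =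
    f , proj₁ (optimal f₀ Pf₀) , λ g → proj₂ ∘ optimal g
    where
    score : Vector A n → ℕ
    score g = guard (P? g) (s g)
    optimum : ∃[ f ] ∀ g → score g ≤ score f
    optimum = maximise n score λ g≗h →
      guard-cong (P? _) (P? _) (P-cong g≗h) (P-cong (sym ∘ g≗h)) (s-cong g≗h)
    f : Vector A n
    f = proj₁ optimum
    optimal : ∀ g → P g → P f × s g ≤ s f
    optimal g = guard-≤ (P? g) (P? f) (proj₂ optimum g)

sumWhere : (Fin n → Bool) → Vector ℕ n → ℕ
sumWhere p w = sum λ x → if p x then w x else 0

count : (Fin n → Bool) → ℕ
count p = sumWhere p (const 1)

weight : (Fin n → Bool) → ℕ
weight p = sumWhere p toℕ

length-filterᵇ-tabulate : {A : Set} (p : A → Bool) (f : Fin n → A) →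
                          length (filterᵇ p (tabulate f)) ≡ count (p ∘ f)
length-filterᵇ-tabulate {zero}  p f = refl
length-filterᵇ-tabulate {suc n} p f with p (f zero)
... | true  = cong suc (length-filterᵇ-tabulate p (f ∘ suc))
... | false = length-filterᵇ-tabulate p (f ∘ suc)

length-filterᵇ-allFin : (p : Fin n → Bool) → length (filterᵇ p (allFin n)) ≡ count p
length-filterᵇ-allFin p = length-filterᵇ-tabulate p id

sumWhere-cong : {p q : Fin n → Bool} → p ≗ q → ∀ w → sumWhere p w ≡ sumWhere q w
sumWhere-cong p≗q w = sum-cong-≗ λ x → cong (λ b → if b then w x else 0) (p≗q x)

sumWhere-permute : (π : Permutation′ n) (p : Fin n → Bool) (w : Vector ℕ n) →
                   sumWhere (p ∘ (π ⟨$⟩ˡ_)) w ≡ sumWhere p (w ∘ (π ⟨$⟩ʳ_))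
sumWhere-permute π p w = trans (sum-permute _ π)
  (sum-cong-≗ λ x → cong (λ y → if p y then w (π ⟨$⟩ʳ x) else 0) (inverseˡ π))

count-permute : (π : Permutation′ n) (p : Fin n → Bool) → count (p ∘ (π ⟨$⟩ˡ_)) ≡ count p
count-permute π p = sumWhere-permute π p (const 1)

count≤n : (p : Fin n → Bool) → count p ≤ n
count≤n {zero}  p = z≤n
count≤n {suc n} p with p zero
... | true  = s≤s (count≤n (p ∘ suc))
... | false = m≤n⇒m≤1+n (count≤n (p ∘ suc))

count-const-true : ∀ n → count {n} (const true) ≡ n
count-const-true zero    = refl
count-const-true (suc n) = cong suc (count-const-true n)

count-pos : (p : Fin n → Bool) {x : Fin n} → p x ≡ true → 0 < count p
count-pos p {zero}  px rewrite px = z<s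
count-pos p {suc x} px = ≤-trans (count-pos (p ∘ suc) px) (m≤n+m _ _)

sum-mono-≤ : {f g : Vector ℕ n} → (∀ x → f x ≤ g x) → sum f ≤ sum g
sum-mono-≤ {zero}  f≤g = z≤n
sum-mono-≤ {suc n} f≤g = +-mono-≤ (f≤g zero) (sum-mono-≤ (f≤g ∘ suc))

sum-mono-< : {f g : Vector ℕ n} → (∀ x → f x ≤ g x) → ∀ x → f x < g x → sum f < sum g
sum-mono-< {suc n} f≤g zero    fx<gx = +-mono-<-≤ fx<gx (sum-mono-≤ (f≤g ∘ suc))
sum-mono-< {suc n} f≤g (suc x) fx<gx =
  +-mono-≤-< (f≤g zero) (sum-mono-< (f≤g ∘ suc) x fx<gx)

UpwardClosed : (Fin n → Bool) → Set
UpwardClosed p = ∀ {x y} → toℕ x < toℕ y → p x ≡ true → p y ≡ true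

upwardClosed⇒suffix : {p : Fin n → Bool} → UpwardClosed p →
                      ∀ x → p x ≡ true ⇔ n ≤ toℕ x + count p
upwardClosed⇒suffix {suc n} {p} closed x with p zero in p₀
... | true = mk⇔ (λ _ → ≤-trans (≤-reflexive (cong suc (sym count≡n))) (m≤n+m _ (toℕ x)))
                 (λ _ → all x)
  where
  all : ∀ x → p x ≡ true
  all zero    = p₀
  all (suc x) = closed z<s p₀
  count≡n : count (p ∘ suc) ≡ n
  count≡n = trans (sumWhere-cong (all ∘ suc) (const 1)) (count-const-true n)
... | false = shifted x
  where
  shifted : ∀ x → p x ≡ true ⇔ suc n ≤ toℕ x + count (p ∘ suc)
  shifted zero    = mk⇔ (λ p₀≡true → contradiction (trans (sym p₀) p₀≡true) λ ())
                        (λ n<count → contradiction (≤-trans n<count (count≤n (p ∘ suc))) (n≮n n))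
  shifted (suc x) = mk⇔ (s≤s ∘ Equivalence.to ih) (Equivalence.from ih ∘ s≤s⁻¹)
    where
    ih : p (suc x) ≡ true ⇔ n ≤ toℕ x + count (p ∘ suc)
    ih = upwardClosed⇒suffix (λ x<y → closed (s<s x<y)) x

upwardClosed⇒threshold : {p : Fin n → Bool} → UpwardClosed p →
                         ∃[ k ] k ≤ n × (∀ x → p x ≡ true ⇔ k ≤ toℕ x)
upwardClosed⇒threshold {n} {p} closed =
  n ∸ count p , m∸n≤m n (count p) , λ x → shift x ⇔-∘ upwardClosed⇒suffix closed x
  where
  shift : ∀ x → n ≤ toℕ x + count p ⇔ n ∸ count p ≤ toℕ x
  shift x = mk⇔
    (λ n≤x+c → m≤n+o⇒m∸n≤o n (count p) (≤-trans n≤x+c (≤-reflexive (+-comm (toℕ x) _))))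
    (λ n-c≤x → begin
      n                      ≡⟨ m∸n+n≡m (count≤n p) ⟨
      n ∸ count p + count p  ≤⟨ +-monoˡ-≤ (count p) n-c≤x ⟩
      toℕ x + count p        ∎)
    where open ≤-Reasoning

Postpones : Permutation′ n → (Fin n → Bool) → Set
Postpones π p = ∀ x → p x ≡ true → toℕ x ≤ toℕ (π ⟨$⟩ʳ x)

weight-postpone : (π : Permutation′ n) {p : Fin n → Bool} → Postpones π p →
                  ∀ {x} → p x ≡ true → toℕ x < toℕ (π ⟨$⟩ʳ x) →
                  weight p < weight (p ∘ (π ⟨$⟩ˡ_))
weight-postpone π {p} postpones {x} px x<πx = begin-strict
  weight p                      <⟨ sum-mono-< later x strictlyLater ⟩
  sumWhere p (toℕ ∘ (π ⟨$⟩ʳ_))  ≡⟨ sumWhere-permute π p toℕ ⟨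
  weight (p ∘ (π ⟨$⟩ˡ_))        ∎
  where
  open ≤-Reasoning
  later : ∀ y → (if p y then toℕ y else 0) ≤ (if p y then toℕ (π ⟨$⟩ʳ y) else 0)
  later y with p y in py
  ... | true  = postpones y py
  ... | false = z≤n
  strictlyLater : (if p x then toℕ x else 0) < (if p x then toℕ (π ⟨$⟩ʳ x) else 0)
  strictlyLater rewrite px = x<πx

transpose-moves : (i j : Fin n) → transpose i j ⟨$⟩ʳ i ≡ j
transpose-moves i j rewrite dec-true (i ≟ i) refl = refl

transpose-postpones : {i j : Fin n} {p : Fin n → Bool} → toℕ i ≤ toℕ j → p j ≡ false →
                      Postpones (transpose i j) p
transpose-postpones {i = i} {j} i≤j pj x px with x ≟ i
... | yes refl = i≤j
... | no _ with x ≟ j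
...   | yes refl = contradiction (trans (sym px) pj) λ ()
...   | no _     = ≤-refl

<-mono⇒≤-mono : {f : Fin n → ℕ} → (∀ x y → toℕ x < toℕ y → f x ≤ f y) →
                ∀ {x y} → toℕ x ≤ toℕ y → f x ≤ f y
<-mono⇒≤-mono {f = f} mono x≤y with m≤n⇒m<n∨m≡n x≤y
... | inj₁ x<y = mono _ _ x<y
... | inj₂ x≡y = ≤-reflexive (cong f (toℕ-injective x≡y))

pointsAt : Maybe (Fin m) → Fin m → Bool
pointsAt nothing  i = false
pointsAt (just z) i = does (z ≟ i)

assignedTo-pointsAt : (M : Assignment n m) (i : Fin m) (j : Fin n) →
                      assignedTo M i j ≡ pointsAt (M j) i
assignedTo-pointsAt M i j with M j
... | nothing = refl
... | just z with z ≟ i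
...   | yes _ = refl
...   | no  _ = refl

pointsAt-map : (π : Permutation′ m) (y : Maybe (Fin m)) (i : Fin m) →
               pointsAt (Maybe.map (π ⟨$⟩ʳ_) y) i ≡ pointsAt y (π ⟨$⟩ˡ i)
pointsAt-map π nothing  i = refl
pointsAt-map π (just z) i with z ≟ π ⟨$⟩ˡ i
... | yes refl = dec-true (_ ≟ i) (inverseʳ π)
... | no  z≢πi = dec-false (_ ≟ i) λ πz≡i →
  z≢πi (trans (sym (inverseˡ π)) (cong (π ⟨$⟩ˡ_) πz≡i))

matched : Assignment n m → Fin n → Bool
matched M j = isJust (M j)

used : Assignment n m → Fin m → Bool
used M i = 0 <ᵇ degree M i

potential : Assignment n m → ℕ
potential M = weight (matched M) + weight (used M)

size≡count : (M : Assignment n m) → size M ≡ count (matched M)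
size≡count M = length-filterᵇ-allFin (matched M)

degree≡count : (M : Assignment n m) (i : Fin m) → degree M i ≡ count (λ j → pointsAt (M j) i)
degree≡count M i = trans (length-filterᵇ-allFin (assignedTo M i))
                         (sumWhere-cong (assignedTo-pointsAt M i) (const 1))

used⇔positive : (M : Assignment n m) (i : Fin m) → used M i ≡ true ⇔ 0 < degree M i
used⇔positive M i = mk⇔ (<ᵇ⇒< 0 _ ∘ Equivalence.from T-≡) (Equivalence.to T-≡ ∘ <⇒<ᵇ)

degree-pos : (M : Assignment n m) {j : Fin n} {i : Fin m} → M j ≡ just i → 0 < degree M i
degree-pos M {j} {i} Mj≡i = subst (0 <_) (sym (degree≡count M i))
  (count-pos (λ j → pointsAt (M j) i)
             (trans (cong (λ y → pointsAt y i) Mj≡i) (dec-true (i ≟ i) refl)))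

module _ {M M′ : Assignment n m} (M≗M′ : M ≗ M′) where

  size-cong : size M ≡ size M′
  size-cong = trans (size≡count M)
    (trans (sumWhere-cong (cong isJust ∘ M≗M′) (const 1)) (sym (size≡count M′)))

  degree-cong : ∀ i → degree M i ≡ degree M′ i
  degree-cong i = trans (degree≡count M i)
    (trans (sumWhere-cong (cong (λ y → pointsAt y i) ∘ M≗M′) (const 1))
           (sym (degree≡count M′ i)))

  potential-cong : potential M ≡ potential M′
  potential-cong = cong₂ _+_ (sumWhere-cong (cong isJust ∘ M≗M′) toℕ)
                             (sumWhere-cong (λ i → cong (0 <ᵇ_) (degree-cong i)) toℕ)

isPD-cong : {b : Fin n → Fin m → ℕ} {M M′ : Assignment n m} → M ≗ M′ →
            IsPDMatching b M → IsPDMatching b M′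
isPD-cong M≗M′ pd j i M′j≡i =
  subst (_≤ _) (degree-cong M≗M′ i) (pd j i (trans (M≗M′ j) M′j≡i))

isPD? : (b : Fin n → Fin m → ℕ) → Decidable (IsPDMatching b)
isPD? b M = all? λ j → all? λ i → Maybe.≡-dec _≟_ (M j) (just i) →-dec degree M i ≤? b j i

module _ (M : Assignment n m) (π : Permutation′ n) where

  private
    M′ : Assignment n m
    M′ = M ∘ (π ⟨$⟩ˡ_)

  size-relabelJobs : size M′ ≡ size M
  size-relabelJobs =
    trans (size≡count M′) (trans (count-permute π (matched M)) (sym (size≡count M)))

  degree-relabelJobs : ∀ i → degree M′ i ≡ degree M i
  degree-relabelJobs i = trans (degree≡count M′ i)
    (trans (count-permute π (λ j → pointsAt (M j) i)) (sym (degree≡count M i)))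

  used-relabelJobs : used M′ ≗ used M
  used-relabelJobs i = cong (0 <ᵇ_) (degree-relabelJobs i)

  isPD-relabelJobs : {b : Fin n → Fin m → ℕ} →
                     (∀ i {j j′} → toℕ j ≤ toℕ j′ → b j i ≤ b j′ i) →
                     Postpones π (matched M) → IsPDMatching b M → IsPDMatching b M′
  isPD-relabelJobs {b} monoʲ postpones pd j i Mπj≡i = begin
    degree M′ i     ≡⟨ degree-relabelJobs i ⟩
    degree M i      ≤⟨ pd (π ⟨$⟩ˡ j) i Mπj≡i ⟩
    b (π ⟨$⟩ˡ j) i  ≤⟨ monoʲ i earlier ⟩
    b j i           ∎
    where
    open ≤-Reasoning
    earlier : toℕ (π ⟨$⟩ˡ j) ≤ toℕ j
    earlier = subst (λ x → toℕ (π ⟨$⟩ˡ j) ≤ toℕ x) (inverseʳ π)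
                    (postpones (π ⟨$⟩ˡ j) (cong isJust Mπj≡i))

  potential-relabelJobs : Postpones π (matched M) →
                          ∀ {j} → matched M j ≡ true → toℕ j < toℕ (π ⟨$⟩ʳ j) →
                          potential M < potential M′
  potential-relabelJobs postpones mj j<πj = begin-strict
    weight (matched M) + weight (used M)
      <⟨ +-monoˡ-< _ (weight-postpone π postpones mj j<πj) ⟩
    weight (matched M′) + weight (used M)
      ≡⟨ cong (weight (matched M′) +_) (sumWhere-cong used-relabelJobs toℕ) ⟨
    potential M′
      ∎
    where open ≤-Reasoning

module _ (M : Assignment n m) (π : Permutation′ m) where

  private
    M′ : Assignment n m
    M′ = Maybe.map (π ⟨$⟩ʳ_) ∘ M

  matched-relabelMachines : matched M′ ≗ matched M
  matched-relabelMachines j with M j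
  ... | nothing = refl
  ... | just _  = refl

  size-relabelMachines : size M′ ≡ size M
  size-relabelMachines = trans (size≡count M′)
    (trans (sumWhere-cong matched-relabelMachines (const 1)) (sym (size≡count M)))

  degree-relabelMachines : ∀ i → degree M′ i ≡ degree M (π ⟨$⟩ˡ i)
  degree-relabelMachines i = trans (degree≡count M′ i)
    (trans (sumWhere-cong (λ j → pointsAt-map π (M j) i) (const 1))
           (sym (degree≡count M (π ⟨$⟩ˡ i))))

  used-relabelMachines : used M′ ≗ used M ∘ (π ⟨$⟩ˡ_)
  used-relabelMachines i = cong (0 <ᵇ_) (degree-relabelMachines i)

  isPD-relabelMachines : {b : Fin n → Fin m → ℕ} →
                         (∀ j {i i′} → toℕ i ≤ toℕ i′ → b j i ≤ b j i′) →
                         Postpones π (used M) → IsPDMatching b M → IsPDMatching b M′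
  isPD-relabelMachines {b} monoⁱ postpones pd j i M′j≡i with M j in Mj≡z
  isPD-relabelMachines {b} monoⁱ postpones pd j _ refl | just z = begin
    degree M′ (π ⟨$⟩ʳ z)          ≡⟨ degree-relabelMachines (π ⟨$⟩ʳ z) ⟩
    degree M (π ⟨$⟩ˡ (π ⟨$⟩ʳ z))  ≡⟨ cong (degree M) (inverseˡ π) ⟩
    degree M z                    ≤⟨ pd j z Mj≡z ⟩
    b j z                         ≤⟨ monoⁱ j (postpones z usedz) ⟩
    b j (π ⟨$⟩ʳ z)                ∎
    where
    open ≤-Reasoning
    usedz : used M z ≡ true
    usedz = Equivalence.from (used⇔positive M z) (degree-pos M Mj≡z)

  potential-relabelMachines : Postpones π (used M) →
                              ∀ {i} → used M i ≡ true → toℕ i < toℕ (π ⟨$⟩ʳ i) →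
                              potential M < potential M′
  potential-relabelMachines postpones ui i<πi = begin-strict
    weight (matched M) + weight (used M)
      <⟨ +-monoʳ-< _ (weight-postpone π postpones ui i<πi) ⟩
    weight (matched M) + weight (used M ∘ (π ⟨$⟩ˡ_))
      ≡⟨ cong₂ _+_ (sumWhere-cong matched-relabelMachines toℕ)
                   (sumWhere-cong used-relabelMachines toℕ) ⟨
    potential M′
      ∎
    where open ≤-Reasoning

allTargets : ∀ m → List (Maybe (Fin m))
allTargets m = nothing ∷ map just (allFin m)

∈-allTargets : (y : Maybe (Fin m)) → y ∈ allTargets m
∈-allTargets nothing  = here refl
∈-allTargets (just i) = there (∈-map⁺ just (∈-allFin i))

module _ (b : Fin n → Fin m → ℕ) where

  maximumPDMatching : ∃[ M ] IsMaxPDMatching b M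
  maximumPDMatching = maximiseOn nothing (allTargets m) ∈-allTargets
    (IsPDMatching b) (isPD? b) isPD-cong size size-cong {λ _ → nothing} (λ _ _ ())

  optimalMaxPDMatching : ∃[ M ] IsMaxPDMatching b M ×
    (∀ M′ → IsPDMatching b M′ → size M′ ≡ size M → potential M′ ≤ potential M)
  optimalMaxPDMatching =
    let M₀ , pd₀ , maximum₀ = maximumPDMatching
        M , (pd , sz) , optimal = maximiseOn nothing (allTargets m) ∈-allTargets
          (λ M → IsPDMatching b M × size M ≡ size M₀)
          (λ M → isPD? b M ×-dec size M ℕ.≟ size M₀)
          (λ M≗M′ (pd , sz) → isPD-cong M≗M′ pd , trans (sym (size-cong M≗M′)) sz)
          potential potential-cong (pd₀ , refl)
    in M , (pd , λ M′ pd′ → subst (size M′ ≤_) (sym sz) (maximum₀ M′ pd′)) ,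
       λ M′ pd′ sz′ → optimal M′ (pd′ , trans sz′ sz)

module _ {b : Fin n → Fin m → ℕ} (mono : Monotonous b)
         {M : Assignment n m} (pd : IsPDMatching b M)
         (optimal : ∀ M′ → IsPDMatching b M′ → size M′ ≡ size M →
                    potential M′ ≤ potential M)
         where

  matched-upwardClosed : UpwardClosed (matched M)
  matched-upwardClosed {j} {j′} j<j′ mj with matched M j′ in mj′
  ... | true  = refl
  ... | false = contradiction (optimal _ pd′ (size-relabelJobs M π)) (<⇒≱ gain)
    where
    π : Permutation′ n
    π = transpose j j′
    postpones : Postpones π (matched M)
    postpones = transpose-postpones (<⇒≤ j<j′) mj′
    pd′ : IsPDMatching b (M ∘ (π ⟨$⟩ˡ_))
    pd′ = isPD-relabelJobs M π (λ i → <-mono⇒≤-mono (proj₂ mono i)) postpones pd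
    gain : potential M < potential (M ∘ (π ⟨$⟩ˡ_))
    gain = potential-relabelJobs M π postpones mj
             (subst (toℕ j <_) (cong toℕ (sym (transpose-moves j j′))) j<j′)

  used-upwardClosed : UpwardClosed (used M)
  used-upwardClosed {i} {i′} i<i′ ui with used M i′ in ui′
  ... | true  = refl
  ... | false = contradiction (optimal _ pd′ (size-relabelMachines M π)) (<⇒≱ gain)
    where
    π : Permutation′ m
    π = transpose i i′
    postpones : Postpones π (used M)
    postpones = transpose-postpones (<⇒≤ i<i′) ui′
    pd′ : IsPDMatching b (Maybe.map (π ⟨$⟩ʳ_) ∘ M)
    pd′ = isPD-relabelMachines M π (λ j → <-mono⇒≤-mono (proj₁ mono j)) postpones pd
    gain : potential M < potential (Maybe.map (π ⟨$⟩ʳ_) ∘ M)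
    gain = potential-relabelMachines M π postpones ui
             (subst (toℕ i <_) (cong toℕ (sym (transpose-moves i i′))) i<i′)

mainTheorem3 : (n m : ℕ) (b : Fin n → Fin m → ℕ) → Monotonous b →
    Σ (Assignment n m) λ M* → IsMaxPDMatching b M*
      × ((j : Fin n) → (Matched M* j ⇔ n ≤ toℕ j + size M*))
      × (∃[ i* ] (i* ≤ m × ((i : Fin m) → ((0 < degree M* i) ⇔ i* ≤ toℕ i))))
mainTheorem3 n m b mono =
  let M* , isMax , optimal = optimalMaxPDMatching b
      pd = proj₁ isMax
      i* , i*≤m , threshold = upwardClosed⇒threshold (used-upwardClosed mono pd optimal)
  in M* , isMax ,
     (λ j → subst (λ s → Matched M* j ⇔ n ≤ toℕ j + s) (sym (size≡count M*))
                  (upwardClosed⇒suffix (matched-upwardClosed mono pd optimal) j)) ,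
     (i* , i*≤m , λ i → threshold i ⇔-∘ ⇔-sym (used⇔positive M* i))
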